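{- For every integer $n\ge 3$, $\kappa_2(Q_n^3)\le 6n-7$.
   Context: The $3$-ary $n$-cube $Q_n^3$ is the graph whose vertices are the strings $x_1x_2\cdots x_n$ with each $x_i\in\{0,1,2\}$, two vertices being adjacent iff they differ in exactly one coordinate (equivalently, iff their Lee distance $D_L(x,y)=\sum_{i}\min((x_i-y_i)\bmod 3,\,3-((x_i-y_i)\bmod 3))$ equals $1$). For a graph $G$ and integer $h\ge 0$, a vertex set $S\subseteq V(G)$ is an $h$-extra vertex-cut if $G-S$ is disconnected and every component of $G-S$ has more than $h$ vertices; $\kappa_h(G)$ is the minimum cardinality of an $h$-extra vertex-cut. -}

module Defs where

open import Data.Nat using (ℕ; _<_; _≤_)
open import Data.Fin using (Fin)
open import Data.Vec using (Vec; lookup)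
open import Data.List using (List; length)
open import Data.List.Membership.Propositional using (_∈_; _∉_)
open import Data.List.Relation.Unary.All using (All)
open import Data.List.Relation.Unary.Unique.Propositional using (Unique)
open import Data.Product using (Σ; ∃; _×_; _,_)
open import Relation.Binary.PropositionalEquality using (_≡_; _≢_)
open import Relation.Nullary using (¬_)

Vertex : ℕ → Set
Vertex n = Vec (Fin 3) n

Adj : ∀ {n} → Vertex n → Vertex n → Set
Adj {n} x y = Σ (Fin n) λ i →
  (lookup x i ≢ lookup y i) × (∀ j → j ≢ i → lookup x j ≡ lookup y j)

-- A (finite) vertex set is given as a duplicate-free list of vertices;
-- its cardinality is the length of the list.

data Reach {n : ℕ} (S : List (Vertex n)) : Vertex n → Vertex n → Set where
  here  : ∀ {x} → x ∉ S → Reach S x x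
  step  : ∀ {x y z} → x ∉ S → Adj x y → Reach S y z → Reach S x z

Disconnected : ∀ {n} → List (Vertex n) → Set
Disconnected {n} S = Σ (Vertex n) λ x → Σ (Vertex n) λ y →
  (x ∉ S) × (y ∉ S) × ¬ Reach S x y

ComponentsLarger : ∀ {n} → ℕ → List (Vertex n) → Set
ComponentsLarger {n} h S = ∀ (x : Vertex n) → x ∉ S →
  Σ (List (Vertex n)) λ L → Unique L × (h < length L) × All (Reach S x) L

IsExtraCut : ∀ {n} → ℕ → List (Vertex n) → Set
IsExtraCut h S = Disconnected S × ComponentsLarger h S

-- Write a vertex of Q_{2+k}^3 as p ++ t with p ∈ Q_2^3 and t ∈ Q_k^3.  The core
-- A = {00, 10, 11} × {0ᵏ} spans a path, and the cut is its neighbourhood: the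
-- five neighbours of the path inside Q_2^3 (followed by 0ᵏ), together with
-- p ++ t for p on the path and t one of the 2k neighbours of 0ᵏ; that is
-- 5 + 3·2k = 6n − 7 vertices.  A is then a component with three vertices.  Any
-- other vertex outside the cut either has a nonzero tail t, and reaches the
-- whole row 20t, 21t, 22t (no cut vertex has prefix 2c and a nonzero tail), or
-- it is 22 0ᵏ, which reaches 22c 0ᵏ⁻¹ for every c; the latter needs k ≥ 1,
-- i.e. n ≥ 3.
module Submission where

open import Defs
open import Data.Nat using (ℕ; zero; suc; _+_; _*_; _∸_; _≤_; _<_; z≤n; s≤s)
open import Data.Nat.Properties using (≤-reflexive; *-assoc; *-distribˡ-+; m+n∸m≡n)
open import Data.Fin using (Fin; zero; suc)
open import Data.Fin.Properties using (_≟_; suc-injective)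
open import Data.Vec using ([]; _∷_; _++_; lookup; replicate; _[_]≔_)
open import Data.Vec.Properties
  using (≡-dec; ∷-injectiveˡ; ∷-injectiveʳ; ++-injective; ++-injectiveˡ; tabulate∘lookup; tabulate-cong; []≔-lookup; lookup∘update; lookup∘update′)
open import Data.List using (List; []; _∷_; length; map; cartesianProductWith)
  renaming (_++_ to _++ₗ_)
open import Data.List.Properties using (length-++; length-map)
open import Data.List.Membership.Propositional using (_∈_; _∉_)
open import Data.List.Membership.Propositional.Properties
  using (∈-map⁺; ∈-map⁻; ∈-++⁺ˡ; ∈-++⁺ʳ; ∈-++⁻; ∈-cartesianProductWith⁺; ∈-cartesianProductWith⁻)
open import Data.List.Membership.DecPropositional (≡-dec {n = 2} (_≟_ {3})) using (_∈?_)
open import Data.List.Relation.Unary.All as All using (All; []; _∷_)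
import Data.List.Relation.Unary.All.Properties as All
open import Data.List.Relation.Unary.Any using (here; there)
open import Data.List.Relation.Unary.AllPairs using ([]; _∷_)
open import Data.List.Relation.Unary.Unique.Propositional using (Unique)
open import Data.List.Relation.Unary.Unique.Propositional.Properties
  using (map⁺; ++⁺; cartesianProductWith⁺)
open import Data.List.Relation.Unary.Unique.DecPropositional (≡-dec {n = 2} (_≟_ {3})) using (unique?)
open import Data.Product using (Σ; _×_; _,_; proj₁)
open import Data.Sum using (_⊎_; inj₁; inj₂)
open import Data.Empty using (⊥-elim)
open import Function using (_∘_)
open import Relation.Binary.PropositionalEquality using (_≡_; _≢_; refl; sym; trans; cong; cong₂; subst; module ≡-Reasoning)
open import Relation.Nullary using (¬_; yes; no)
open import Relation.Nullary.Decidable using (from-yes; from-no)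

pattern 𝟎 = zero
pattern 𝟏 = suc zero
pattern 𝟐 = suc (suc zero)

private
  variable
    n k : ℕ
    a b : Fin 3
    x y z : Vertex n
    S : List (Vertex n)

lookup-ext : (∀ i → lookup x i ≡ lookup y i) → x ≡ y
lookup-ext {x = x} {y} eq =
  trans (sym (tabulate∘lookup x)) (trans (tabulate-cong eq) (tabulate∘lookup y))

Adj-sym : Adj x y → Adj y x
Adj-sym (i , x≢y , agree) = i , x≢y ∘ sym , λ j j≢i → sym (agree j j≢i)

adj-head : a ≢ b → Adj (a ∷ x) (b ∷ x)
adj-head a≢b = 𝟎 , a≢b , λ { 𝟎 0≢0 → ⊥-elim (0≢0 refl) ; (suc j) _ → refl }

adj-tail : Adj x y → Adj (a ∷ x) (a ∷ y)
adj-tail (i , x≢y , agree) = suc i , x≢y , λ { 𝟎 _ → refl ; (suc j) j≢i → agree j (j≢i ∘ cong suc) }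

adj-∷⁻ : Adj (a ∷ x) (b ∷ y) → (a ≢ b × x ≡ y) ⊎ (a ≡ b × Adj x y)
adj-∷⁻ (𝟎 , a≢b , agree) = inj₁ (a≢b , lookup-ext λ j → agree (suc j) λ ())
adj-∷⁻ (suc i , x≢y , agree) =
  inj₂ (agree 𝟎 (λ ()) , i , x≢y , λ j j≢i → agree (suc j) (j≢i ∘ suc-injective))

adj-++⁻ : ∀ {m} (p q : Vertex m) {t u : Vertex n} →
          Adj (p ++ t) (q ++ u) → (Adj p q × t ≡ u) ⊎ (p ≡ q × Adj t u)
adj-++⁻ [] [] adj = inj₂ (refl , adj)
adj-++⁻ (a ∷ p) (b ∷ q) adj with adj-∷⁻ adj
... | inj₁ (a≢b , eq) with refl , t≡u ← ++-injective p q eq = inj₁ (adj-head a≢b , t≡u)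
... | inj₂ (refl , adj′) with adj-++⁻ p q adj′
...   | inj₁ (p~q , t≡u) = inj₁ (adj-tail p~q , t≡u)
...   | inj₂ (refl , t~u) = inj₂ (refl , t~u)

≡⊎adj-update : ∀ (i : Fin n) c → x ≡ x [ i ]≔ c ⊎ Adj x (x [ i ]≔ c)
≡⊎adj-update {x = x} i c with lookup x i ≟ c
... | yes refl = inj₁ (sym ([]≔-lookup x i))
... | no xᵢ≢c = inj₂ (i , (λ eq → xᵢ≢c (trans eq (lookup∘update i x c)))
                        , λ j j≢i → sym (lookup∘update′ j≢i x c))

Reach-start : Reach S x y → x ∉ S
Reach-start (here x∉S) = x∉S
Reach-start (step x∉S _ _) = x∉S

Reach-trans : Reach S x y → Reach S y z → Reach S x z
Reach-trans (here _) r = r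
Reach-trans (step x∉S x~y r) r′ = step x∉S x~y (Reach-trans r r′)

Reach-sym : Reach S x y → Reach S y x
Reach-sym (here x∉S) = here x∉S
Reach-sym {x = x} (step {y = y} x∉S x~y r) =
  Reach-trans (Reach-sym r) (step (Reach-start r) (Adj-sym {x = x} {y} x~y) (here x∉S))

Reach-invariant : (P : Vertex n → Set) → (∀ {x y} → P x → Adj x y → y ∉ S → P y) →
                  Reach S x y → P x → P y
Reach-invariant P closed (here _) Px = Px
Reach-invariant P closed (step _ x~y r) Px = Reach-invariant P closed r (closed Px x~y (Reach-start r))

Reach-update : ∀ (i : Fin n) c → x ∉ S → x [ i ]≔ c ∉ S → Reach S x (x [ i ]≔ c)
Reach-update {x = x} {S = S} i c x∉S x′∉S with ≡⊎adj-update i c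
... | inj₁ x≡x′ = subst (Reach S x) x≡x′ (here x∉S)
... | inj₂ x~x′ = step x∉S x~x′ (here x′∉S)

three-reachable : ∀ {u v w} → Reach S x u → Reach S x v → Reach S x w →
                  u ≢ v → u ≢ w → v ≢ w →
                  Σ (List (Vertex n)) λ L → Unique L × 2 < length L × All (Reach S x) L
three-reachable {u = u} {v} {w} ru rv rw u≢v u≢w v≢w =
  u ∷ v ∷ w ∷ [] , ((u≢v ∷ u≢w ∷ []) ∷ (v≢w ∷ []) ∷ [] ∷ []) , s≤s (s≤s (s≤s z≤n)) , ru ∷ rv ∷ rw ∷ []

origin : ∀ k → Vertex k
origin k = replicate k 𝟎

originNeighbours : ∀ k → List (Vertex k)
originNeighbours zero = []
originNeighbours (suc k) = (𝟏 ∷ origin k) ∷ (𝟐 ∷ origin k) ∷ map (𝟎 ∷_) (originNeighbours k)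

originNeighbours-unique : ∀ k → Unique (originNeighbours k)
originNeighbours-unique zero = []
originNeighbours-unique (suc k) =
  ((λ ()) ∷ headed-apart (λ ())) ∷ headed-apart (λ ()) ∷ map⁺ ∷-injectiveʳ (originNeighbours-unique k)
  where
  headed-apart : ∀ {c} → c ≢ 𝟎 → All (c ∷ origin k ≢_) (map (𝟎 ∷_) (originNeighbours k))
  headed-apart c≢0 = All.map⁺ (All.universal (λ _ → c≢0 ∘ ∷-injectiveˡ) _)

length-originNeighbours : ∀ k → length (originNeighbours k) ≡ 2 * k
length-originNeighbours zero = refl
length-originNeighbours (suc k) = begin
  2 + length (map (𝟎 ∷_) (originNeighbours k)) ≡⟨ cong (2 +_) (length-map (𝟎 ∷_) (originNeighbours k)) ⟩
  2 + length (originNeighbours k)               ≡⟨ cong (2 +_) (length-originNeighbours k) ⟩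
  2 + 2 * k                                     ≡⟨ sym (*-distribˡ-+ 2 1 k) ⟩
  2 * suc k                                     ∎
  where open ≡-Reasoning

∈-originNeighbours⁺ : ∀ {t : Vertex k} → Adj (origin k) t → t ∈ originNeighbours k
∈-originNeighbours⁺ {t = c ∷ t} adj with adj-∷⁻ adj
... | inj₁ (0≢c , refl) with c
...   | 𝟎 = ⊥-elim (0≢c refl)
...   | 𝟏 = here refl
...   | 𝟐 = there (here refl)
∈-originNeighbours⁺ {t = c ∷ t} adj | inj₂ (refl , adj′) =
  there (there (∈-map⁺ (𝟎 ∷_) (∈-originNeighbours⁺ adj′)))

∈-originNeighbours⇒≢origin : ∀ {t : Vertex k} → t ∈ originNeighbours k → t ≢ origin k
∈-originNeighbours⇒≢origin {suc k} (here refl) ()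
∈-originNeighbours⇒≢origin {suc k} (there (here refl)) ()
∈-originNeighbours⇒≢origin {suc k} (there (there t∈)) with ∈-map⁻ (𝟎 ∷_) t∈
... | _ , t′∈ , refl = ∈-originNeighbours⇒≢origin t′∈ ∘ ∷-injectiveʳ

path border : List (Vertex 2)
path = (𝟎 ∷ 𝟎 ∷ []) ∷ (𝟏 ∷ 𝟎 ∷ []) ∷ (𝟏 ∷ 𝟏 ∷ []) ∷ []
border = (𝟐 ∷ 𝟎 ∷ []) ∷ (𝟎 ∷ 𝟏 ∷ []) ∷ (𝟎 ∷ 𝟐 ∷ []) ∷ (𝟏 ∷ 𝟐 ∷ []) ∷ (𝟐 ∷ 𝟏 ∷ []) ∷ []

corner : Vertex 2
corner = 𝟐 ∷ 𝟐 ∷ []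

path⊎border⊎corner : ∀ p → p ∈ path ⊎ p ∈ border ⊎ p ≡ corner
path⊎border⊎corner (𝟎 ∷ 𝟎 ∷ []) = inj₁ (here refl)
path⊎border⊎corner (𝟏 ∷ 𝟎 ∷ []) = inj₁ (there (here refl))
path⊎border⊎corner (𝟏 ∷ 𝟏 ∷ []) = inj₁ (there (there (here refl)))
path⊎border⊎corner (𝟐 ∷ 𝟎 ∷ []) = inj₂ (inj₁ (here refl))
path⊎border⊎corner (𝟎 ∷ 𝟏 ∷ []) = inj₂ (inj₁ (there (here refl)))
path⊎border⊎corner (𝟎 ∷ 𝟐 ∷ []) = inj₂ (inj₁ (there (there (here refl))))
path⊎border⊎corner (𝟏 ∷ 𝟐 ∷ []) = inj₂ (inj₁ (there (there (there (here refl)))))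
path⊎border⊎corner (𝟐 ∷ 𝟏 ∷ []) = inj₂ (inj₁ (there (there (there (there (here refl))))))
path⊎border⊎corner (𝟐 ∷ 𝟐 ∷ []) = inj₂ (inj₂ refl)

path-avoids-𝟐 : ∀ {p} → p ∈ path → ∀ i → lookup p i ≢ 𝟐
path-avoids-𝟐 (here refl) 𝟎 ()
path-avoids-𝟐 (here refl) 𝟏 ()
path-avoids-𝟐 (there (here refl)) 𝟎 ()
path-avoids-𝟐 (there (here refl)) 𝟏 ()
path-avoids-𝟐 (there (there (here refl))) 𝟎 ()
path-avoids-𝟐 (there (there (here refl))) 𝟏 ()

𝟐-headed∉path : ∀ c → (𝟐 ∷ c ∷ []) ∉ path
𝟐-headed∉path c 2c∈ = path-avoids-𝟐 2c∈ 𝟎 refl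

path∩border≡∅ : ∀ {p} → p ∈ path → p ∉ border
path∩border≡∅ {p} (here refl) = from-no (p ∈? border)
path∩border≡∅ {p} (there (here refl)) = from-no (p ∈? border)
path∩border≡∅ {p} (there (there (here refl))) = from-no (p ∈? border)

-- The corner differs from every path vertex in both coordinates.
path-boundary : ∀ {p q} → p ∈ path → Adj p q → q ∈ path ⊎ q ∈ border
path-boundary {q = q} p∈ (i , _ , agree) with path⊎border⊎corner q
... | inj₁ q∈ = inj₁ q∈
... | inj₂ (inj₁ q∈) = inj₂ q∈
... | inj₂ (inj₂ refl) with i
...   | 𝟎 = ⊥-elim (path-avoids-𝟐 p∈ 𝟏 (agree 𝟏 λ ()))
...   | 𝟏 = ⊥-elim (path-avoids-𝟐 p∈ 𝟎 (agree 𝟎 λ ()))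

length-cartesianProductWith : ∀ {A B C : Set} (f : A → B → C) xs ys →
  length (cartesianProductWith f xs ys) ≡ length xs * length ys
length-cartesianProductWith f [] ys = refl
length-cartesianProductWith f (x ∷ xs) ys = begin
  length (map (f x) ys ++ₗ cartesianProductWith f xs ys)     ≡⟨ length-++ (map (f x) ys) ⟩
  length (map (f x) ys) + length (cartesianProductWith f xs ys)
    ≡⟨ cong₂ _+_ (length-map (f x) ys) (length-cartesianProductWith f xs ys) ⟩
  length ys + length xs * length ys                            ∎
  where open ≡-Reasoning

borderPart pathPart cut : ∀ k → List (Vertex (2 + k))
borderPart k = cartesianProductWith _++_ border (origin k ∷ [])
pathPart k = cartesianProductWith _++_ path (originNeighbours k)
cut k = borderPart k ++ₗ pathPart k

∈-cut⁻ : ∀ p {t : Vertex k} → p ++ t ∈ cut k →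
         (p ∈ border × t ≡ origin k) ⊎ (p ∈ path × t ∈ originNeighbours k)
∈-cut⁻ {k} p pt∈ with ∈-++⁻ (borderPart k) pt∈
... | inj₁ pt∈₁ with ∈-cartesianProductWith⁻ _++_ border (origin k ∷ []) pt∈₁
...   | q , u , q∈ , here refl , eq with refl , refl ← ++-injective p q eq = inj₁ (q∈ , refl)
∈-cut⁻ {k} p pt∈ | inj₂ pt∈₂ with ∈-cartesianProductWith⁻ _++_ path (originNeighbours k) pt∈₂
...   | q , u , q∈ , u∈ , eq with refl , refl ← ++-injective p q eq = inj₂ (q∈ , u∈)

∈-cut⁺ : ∀ {p} {t : Vertex k} →
         (p ∈ border × t ≡ origin k) ⊎ (p ∈ path × t ∈ originNeighbours k) → p ++ t ∈ cut k
∈-cut⁺ {k} (inj₁ (p∈ , refl)) = ∈-++⁺ˡ (∈-cartesianProductWith⁺ _++_ {ys = origin k ∷ []} p∈ (here refl))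
∈-cut⁺ {k} (inj₂ (p∈ , t∈)) = ∈-++⁺ʳ (borderPart k) (∈-cartesianProductWith⁺ _++_ p∈ t∈)

path-∉cut : ∀ {p} → p ∈ path → p ++ origin k ∉ cut k
path-∉cut {p = p} p∈ p0∈ with ∈-cut⁻ p p0∈
... | inj₁ (p∈′ , _) = path∩border≡∅ p∈ p∈′
... | inj₂ (_ , 0∈) = ∈-originNeighbours⇒≢origin 0∈ refl

corner-∉cut : ∀ {t : Vertex k} → corner ++ t ∉ cut k
corner-∉cut ct∈ with ∈-cut⁻ corner ct∈
... | inj₁ (c∈ , _) = from-no (corner ∈? border) c∈
... | inj₂ (c∈ , _) = 𝟐-headed∉path 𝟐 c∈

offPath-∉cut : ∀ {p} {t : Vertex k} → p ∉ path → t ≢ origin k → p ++ t ∉ cut k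
offPath-∉cut {p = p} p∉ t≢0 pt∈ with ∈-cut⁻ p pt∈
... | inj₁ (_ , t≡0) = t≢0 t≡0
... | inj₂ (p∈ , _) = p∉ p∈

cut-unique : ∀ k → Unique (cut k)
cut-unique k =
  ++⁺ (cartesianProductWith⁺ _++_ (++-injective _ _) (from-yes (unique? border)) ([] ∷ []))
      (cartesianProductWith⁺ _++_ (++-injective _ _) (from-yes (unique? path)) (originNeighbours-unique k))
      borderPart∩pathPart≡∅
  where
  borderPart∩pathPart≡∅ : ∀ {v} → ¬ (v ∈ borderPart k × v ∈ pathPart k)
  borderPart∩pathPart≡∅ (v∈₁ , v∈₂)
    with p , _ , p∈ , _ , refl ← ∈-cartesianProductWith⁻ _++_ border (origin k ∷ []) v∈₁
       | q , _ , q∈ , _ , eq ← ∈-cartesianProductWith⁻ _++_ path (originNeighbours k) v∈₂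
    with refl ← ++-injectiveˡ p q eq = path∩border≡∅ q∈ p∈

length-cut : ∀ k → length (cut k) ≡ 6 * (2 + k) ∸ 7
length-cut k = begin
  length (cut k)                      ≡⟨ length-++ (borderPart k) {pathPart k} ⟩
  5 + length (pathPart k)             ≡⟨ cong (5 +_) (length-cartesianProductWith _++_ path (originNeighbours k)) ⟩
  5 + 3 * length (originNeighbours k) ≡⟨ cong (λ m → 5 + 3 * m) (length-originNeighbours k) ⟩
  5 + 3 * (2 * k)                     ≡⟨ cong (5 +_) (sym (*-assoc 3 2 k)) ⟩
  5 + 6 * k                           ≡⟨ sym (m+n∸m≡n 7 (5 + 6 * k)) ⟩
  (12 + 6 * k) ∸ 7                    ≡⟨ cong (_∸ 7) (sym (*-distribˡ-+ 6 2 k)) ⟩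
  6 * (2 + k) ∸ 7                     ∎
  where open ≡-Reasoning

Core : ∀ k → Vertex (2 + k) → Set
Core k (a ∷ b ∷ t) = (a ∷ b ∷ []) ∈ path × t ≡ origin k

core-closed : Core k x → Adj x y → y ∉ cut k → Core k y
core-closed {x = a ∷ b ∷ _} {y = a′ ∷ b′ ∷ _} (p∈ , refl) x~y y∉
  with adj-++⁻ (a ∷ b ∷ []) (a′ ∷ b′ ∷ []) x~y
... | inj₂ (refl , 0~u) = ⊥-elim (y∉ (∈-cut⁺ (inj₂ (p∈ , ∈-originNeighbours⁺ 0~u))))
... | inj₁ (p~q , refl) with path-boundary p∈ p~q
...   | inj₁ q∈ = q∈ , refl
...   | inj₂ q∈ = ⊥-elim (y∉ (∈-cut⁺ (inj₁ (q∈ , refl))))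

cut-disconnects : Disconnected (cut k)
cut-disconnects {k} =
  𝟎 ∷ 𝟎 ∷ origin k , corner ++ origin k , path-∉cut (here refl) , corner-∉cut ,
  λ r → 𝟐-headed∉path 𝟐 (proj₁ (Reach-invariant (Core k) core-closed r (here refl , refl)))

path-connected : ∀ {p q} → p ∈ path → q ∈ path → Reach (cut k) (p ++ origin k) (q ++ origin k)
path-connected {k} p∈ q∈ = Reach-trans (Reach-hub p∈) (Reach-sym (Reach-hub q∈))
  where
  Reach-hub : ∀ {p} → p ∈ path → Reach (cut k) (p ++ origin k) (𝟏 ∷ 𝟎 ∷ origin k)
  Reach-hub (here refl) = Reach-update 𝟎 𝟏 (path-∉cut (here refl)) (path-∉cut (there (here refl)))
  Reach-hub (there (here refl)) = here (path-∉cut (there (here refl)))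
  Reach-hub (there (there (here refl))) =
    Reach-update 𝟏 𝟎 (path-∉cut (there (there (here refl)))) (path-∉cut (there (here refl)))

cut-components>2 : ∀ m → ComponentsLarger 2 (cut (suc m))
cut-components>2 m (a ∷ b ∷ t) x∉ with ≡-dec _≟_ t (origin (suc m))
... | no t≢0 = three-reachable (row 𝟎) (row 𝟏) (row 𝟐) (λ ()) (λ ()) (λ ())
  where
  row-∉cut : ∀ c → 𝟐 ∷ c ∷ t ∉ cut (suc m)
  row-∉cut c = offPath-∉cut (𝟐-headed∉path c) t≢0

  row : ∀ c → Reach (cut (suc m)) (a ∷ b ∷ t) (𝟐 ∷ c ∷ t)
  row c = Reach-trans (Reach-update 𝟎 𝟐 x∉ (row-∉cut b)) (Reach-update 𝟏 c (row-∉cut b) (row-∉cut c))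
... | yes refl with path⊎border⊎corner (a ∷ b ∷ [])
...   | inj₁ p∈ = three-reachable (path-connected p∈ (here refl)) (path-connected p∈ (there (here refl)))
                               (path-connected p∈ (there (there (here refl)))) (λ ()) (λ ()) (λ ())
...   | inj₂ (inj₁ p∈) = ⊥-elim (x∉ (∈-cut⁺ (inj₁ (p∈ , refl))))
...   | inj₂ (inj₂ refl) = three-reachable (column 𝟎) (column 𝟏) (column 𝟐) (λ ()) (λ ()) (λ ())
  where
  column : ∀ c → Reach (cut (suc m)) (corner ++ origin (suc m)) (corner ++ c ∷ origin m)
  column c = Reach-update 𝟐 c corner-∉cut corner-∉cut

lemma7 : ∀ (n : ℕ) → 3 ≤ n →
    Σ (List (Vertex n)) λ S → Unique S × IsExtraCut 2 S × length S ≤ 6 * n ∸ 7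
lemma7 (suc (suc (suc m))) (s≤s (s≤s (s≤s z≤n))) =
  cut (suc m) , cut-unique (suc m) , (cut-disconnects , cut-components>2 m) , ≤-reflexive (length-cut (suc m))
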